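{- Let $f=f_1\cdots f_n$ be the canonical form of a merging-free partition $P$ of $[n]$. Then $f$ avoids the pattern $212$ if and only if $f$ is weakly uni-modal.
   Context: A set partition $P=B_1/\cdots/B_k$ of $[n]$ in block representation has blocks ordered by increasing minima; it is merging-free if $\max B_i>\min B_{i+1}$ for $1\le i\le k-1$. Its canonical form is $f=f_1\cdots f_n$ with $j\in B_{f_j}$ for each $j$. $f$ avoids $212$ if there are no indices $a<b<c$ with $f_a=f_c>f_b$. $f$ is weakly uni-modal if there is $m\le n$ with $f_1\le f_2\le\cdots\le f_m\ge f_{m+1}\ge\cdots\ge f_n$. -}

module Defs where

open import Data.Nat using (ℕ; zero; suc; _≤_; _<_)
open import Data.Fin using (Fin; toℕ)
import Data.Fin as F
open import Data.Product using (Σ; ∃; _×_; _,_)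
open import Data.Sum using (_⊎_)
open import Relation.Nullary using (¬_)
open import Relation.Binary.PropositionalEquality using (_≡_)

-- A word f = f_1 ⋯ f_n is modelled as a function  Fin n → ℕ
-- (position j ∈ Fin n is the 0-based index of the letter f_{j+1}).

-- f is the canonical form of a set partition of [n]: block indices start at 1,
-- and the blocks are ordered by increasing minima, i.e. f is a restricted
-- growth function: every letter is 1 or is one more than some earlier letter.
-- (The block B_i of the partition is {j | f j ≡ i}.)
IsCanonicalForm : {n : ℕ} → (Fin n → ℕ) → Set
IsCanonicalForm {n} f =
  (j : Fin n) → (1 ≤ f j) ×
    ((f j ≡ 1) ⊎ (Σ (Fin n) λ i → (i F.< j) × (suc (f i) ≡ f j)))

-- Merging-free: for consecutive blocks B_i, B_{i+1} (i ≥ 1, B_{i+1} nonempty),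
-- max B_i > min B_{i+1}, i.e. some element of B_{i+1} is smaller than some
-- element of B_i.
MergingFree : {n : ℕ} → (Fin n → ℕ) → Set
MergingFree {n} f =
  (i : ℕ) → 1 ≤ i → (Σ (Fin n) λ b → f b ≡ suc i) →
    Σ (Fin n) λ a → Σ (Fin n) λ b → (f a ≡ i) × (f b ≡ suc i) × (b F.< a)

Avoids212 : {n : ℕ} → (Fin n → ℕ) → Set
Avoids212 {n} f =
  ¬ (Σ (Fin n) λ a → Σ (Fin n) λ b → Σ (Fin n) λ c →
       (a F.< b) × (b F.< c) × (f a ≡ f c) × (f b < f a))

WeaklyUnimodal : {n : ℕ} → (Fin n → ℕ) → Set
WeaklyUnimodal {n} f =
  Σ ℕ λ m →
    ((i j : Fin n) → i F.< j → toℕ j ≤ m → f i ≤ f j) ×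
    ((i j : Fin n) → i F.< j → m ≤ toℕ i → f j ≤ f i)

{-# OPTIONS --safe #-}
-- A 212-avoiding word that is not weakly unimodal has a valley i < j < l with
-- f_j < f_i and f_j < f_l.  The values occurring before j then include one above
-- f_j, and this set is closed under passing to any smaller positive value (f is a
-- restricted growth function) and to the successor of any value above f_j:
-- merging-freeness puts an occurrence of w + 1 before one of w, and if that
-- occurrence of w + 1 is not before j, the w after it forms a 212 around j.
-- Hence f_l occurs before j, which gives a 212 around j as well.
module Submission where

open import Defs
open import Data.Nat using (ℕ; zero; suc; _≤_; _<_; z≤n; s≤s; _≤?_)
open import Data.Nat.Properties
  using (≤-refl; ≤-trans; <-≤-trans; ≤-<-trans; <⇒≤; <⇒≱; ≰⇒>; ≮⇒≥; m≤n⇒m<n∨m≡n; suc-injective; ≤-pred; n≤1+n; ≤-totalOrder)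
open import Data.Fin using (Fin; toℕ)
import Data.Fin as F
open import Data.Fin.Properties using (toℕ-injective)
open import Data.List using (allFin)
open import Data.List.Extrema ≤-totalOrder using (argmax; f[xs]≤f[argmax])
import Data.List.Relation.Unary.All as All
open import Data.List.Membership.Propositional.Properties using (∈-allFin)
open import Data.Product using (Σ-syntax; _×_; _,_; proj₁; proj₂)
open import Data.Sum using (inj₁; inj₂)
open import Data.Empty using (⊥-elim)
open import Relation.Nullary using (¬_; yes; no)
open import Relation.Binary.PropositionalEquality using (_≡_; refl; sym; trans; subst)
open import Function.Bundles using (_⇔_; mk⇔)

module _ {n : ℕ} (f : Fin n → ℕ) where

  Valley : Set
  Valley = Σ[ i ∈ Fin n ] Σ[ j ∈ Fin n ] Σ[ l ∈ Fin n ]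
             (i F.< j) × (j F.< l) × (f j < f i) × (f j < f l)

  Occurs : ℕ → Set
  Occurs w = Σ[ q ∈ Fin n ] f q ≡ w

  OccursBefore : Fin n → ℕ → Set
  OccursBefore j w = Σ[ p ∈ Fin n ] (p F.< j) × (f p ≡ w)

module _ {n : ℕ} {f : Fin n → ℕ} (canonical : IsCanonicalForm f) where

  occurs-weaklyBefore : ∀ {q w u} → f q ≡ w → 1 ≤ u → u ≤ w →
                        Σ[ p ∈ Fin n ] (p F.≤ q) × (f p ≡ u)
  occurs-weaklyBefore {q} {zero} _ 1≤u u≤0 = ⊥-elim (<⇒≱ 1≤u u≤0)
  occurs-weaklyBefore {q} {suc w} {u} fq≡1+w 1≤u u≤1+w with m≤n⇒m<n∨m≡n u≤1+w
  ... | inj₂ u≡1+w = q , ≤-refl , trans fq≡1+w (sym u≡1+w)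
  ... | inj₁ (s≤s u≤w) with proj₂ (canonical q)
  ...   | inj₁ fq≡1 = ⊥-elim (<⇒≱ 1≤u (subst (u ≤_) (suc-injective (trans (sym fq≡1+w) fq≡1)) u≤w))
  ...   | inj₂ (i , i<q , 1+fi≡fq) with occurs-weaklyBefore {i} (suc-injective (trans 1+fi≡fq fq≡1+w)) 1≤u u≤w
  ...     | p , p≤i , fp≡u = p , ≤-trans p≤i (<⇒≤ i<q) , fp≡u

  occursBefore-downClosed : ∀ {j w u} → OccursBefore f j w → 1 ≤ u → u ≤ w → OccursBefore f j u
  occursBefore-downClosed (p , p<j , fp≡w) 1≤u u≤w with occurs-weaklyBefore fp≡w 1≤u u≤w
  ... | p′ , p′≤p , fp′≡u = p′ , ≤-<-trans p′≤p p<j , fp′≡u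

  module _ (mergingFree : MergingFree f) (avoids : Avoids212 f) where

    occursBefore-suc : ∀ {j w} → OccursBefore f j w → f j < w → Occurs f (suc w) →
                       OccursBefore f j (suc w)
    occursBefore-suc {j} {w} (p , p<j , fp≡w) fj<w occ
      with mergingFree w (≤-trans (s≤s z≤n) fj<w) occ
    ... | a , b , fa≡w , fb≡1+w , b<a with b F.<? j
    ...   | yes b<j = b , b<j , fb≡1+w
    ...   | no b≮j = ⊥-elim (avoids (p , j , a , p<j , <-≤-trans (≰⇒> b≮j) b<a
                                     , trans fp≡w (sym fa≡w) , subst (f j <_) (sym fp≡w) fj<w))

    occursBefore-all : ∀ {j w u} → OccursBefore f j w → f j < w → Occurs f u → OccursBefore f j u
    occursBefore-all {u = zero} _ _ (q , fq≡0) with subst (1 ≤_) fq≡0 (proj₁ (canonical q))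
    ... | ()
    occursBefore-all {j} {w} {suc u} before fj<w (q , fq≡1+u) with suc u ≤? w
    ... | yes 1+u≤w = occursBefore-downClosed before (s≤s z≤n) 1+u≤w
    ... | no 1+u≰w = occursBefore-suc (occursBefore-all before fj<w occurs-u) (<-≤-trans fj<w w≤u) (q , fq≡1+u)
      where
      w≤u : w ≤ u
      w≤u = ≤-pred (≰⇒> 1+u≰w)
      occurs-u : Occurs f u
      occurs-u with occurs-weaklyBefore fq≡1+u (≤-trans (≤-trans (s≤s z≤n) fj<w) w≤u) (n≤1+n u)
      ... | p , _ , fp≡u = p , fp≡u

    avoids212⇒noValley : ¬ Valley f
    avoids212⇒noValley (i , j , l , i<j , j<l , fj<fi , fj<fl)
      with occursBefore-all (i , i<j , refl) fj<fi (l , refl)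
    ... | p , p<j , fp≡fl = avoids (p , j , l , p<j , j<l , fp≡fl , subst (f j <_) (sym fp≡fl) fj<fl)

noValley⇒weaklyUnimodal : ∀ {n} (f : Fin n → ℕ) → ¬ Valley f → WeaklyUnimodal f
noValley⇒weaklyUnimodal {zero} f _ = 0 , (λ ()) , (λ ())
noValley⇒weaklyUnimodal {suc n} f noValley = toℕ M , rising , falling
  where
  M : Fin (suc n)
  M = argmax f F.zero (allFin (suc n))

  f≤f[M] : ∀ k → f k ≤ f M
  f≤f[M] k = All.lookup (f[xs]≤f[argmax] {f = f} F.zero (allFin (suc n))) (∈-allFin k)

  rising : (i j : Fin (suc n)) → i F.< j → toℕ j ≤ toℕ M → f i ≤ f j
  rising i j i<j j≤M with m≤n⇒m<n∨m≡n j≤M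
  ... | inj₂ j≡M rewrite toℕ-injective j≡M = f≤f[M] i
  ... | inj₁ j<M = ≮⇒≥ λ fj<fi → noValley (i , j , M , i<j , j<M , fj<fi , <-≤-trans fj<fi (f≤f[M] i))

  falling : (i j : Fin (suc n)) → i F.< j → toℕ M ≤ toℕ i → f j ≤ f i
  falling i j i<j M≤i with m≤n⇒m<n∨m≡n M≤i
  ... | inj₂ M≡i rewrite sym (toℕ-injective M≡i) = f≤f[M] j
  ... | inj₁ M<i = ≮⇒≥ λ fi<fj → noValley (M , i , j , M<i , i<j , <-≤-trans fi<fj (f≤f[M] j) , fi<fj)

weaklyUnimodal⇒avoids212 : ∀ {n} (f : Fin n → ℕ) → WeaklyUnimodal f → Avoids212 f
weaklyUnimodal⇒avoids212 f (m , rising , falling) (a , b , c , a<b , b<c , fa≡fc , fb<fa)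
  with toℕ b ≤? m
... | yes b≤m = <⇒≱ fb<fa (rising a b a<b b≤m)
... | no b≰m = <⇒≱ (subst (f b <_) fa≡fc fb<fa) (falling b c b<c (<⇒≤ (≰⇒> b≰m)))

proposition39 : (n : ℕ) (f : Fin n → ℕ) → IsCanonicalForm f → MergingFree f →
    (Avoids212 f ⇔ WeaklyUnimodal f)
proposition39 n f canonical mergingFree =
  mk⇔ (λ avoids → noValley⇒weaklyUnimodal f (avoids212⇒noValley canonical mergingFree avoids))
      (weaklyUnimodal⇒avoids212 f)
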